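{- Let $\mathbf L=(L,\vee,\wedge)$ be a finite lattice with least element $0$ and greatest element $1$, and let $a,b\in L$ with $a<b$ and $L=[0,a]\cup[a,b]\cup[b,1]$. Then \[|P_{\{a,b\}}(\mathbf L)|=2\,|[0,a]|\cdot|[b,1]|+|\{(x,y)\in L^2\mid a<x,y<b;\ x\wedge y=a;\ x\vee y=b\}|.\]
   Context: For a lattice $\mathbf L$ and $S\subseteq L$, $P_S(\mathbf L):=\{(x,y)\in L^2\mid x\wedge y\leq z\leq x\vee y\text{ for all }z\in S\}$. $[c,d]$ denotes the interval $\{x\in L\mid c\leq x\leq d\}$. -}

module Defs where

open import Data.Nat using (ℕ)
open import Data.Fin using (Fin; _≟_)
open import Data.List using (List; length; filter; allFin; cartesianProduct)
open import Data.Product using (_×_; _,_)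
open import Relation.Binary.PropositionalEquality using (_≡_; _≢_)
open import Relation.Nullary using (¬_; Dec)
open import Relation.Nullary.Decidable using (_×-dec_; ¬?)
open import Relation.Unary using (Decidable)

card : ∀ {n} {p} {P : Fin n → Set p} → Decidable P → ℕ
card {n} P? = length (filter P? (allFin n))

card₂ : ∀ {n} {p} {P : Fin n × Fin n → Set p} → Decidable P → ℕ
card₂ {n} P? = length (filter P? (cartesianProduct (allFin n) (allFin n)))

module LatticeNotions {n : ℕ} (_∨_ _∧_ : Fin n → Fin n → Fin n) where

  _≤_ : Fin n → Fin n → Set
  x ≤ y = x ∧ y ≡ x

  _≤?_ : (x y : Fin n) → Dec (x ≤ y)
  x ≤? y = (x ∧ y) ≟ x

  _<_ : Fin n → Fin n → Set
  x < y = x ≤ y × x ≢ y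

  _<?_ : (x y : Fin n) → Dec (x < y)
  x <? y = (x ≤? y) ×-dec ¬? (x ≟ y)

  InInterval : Fin n → Fin n → Fin n → Set
  InInterval c d x = c ≤ x × x ≤ d

  inInterval? : (c d : Fin n) → Decidable (InInterval c d)
  inInterval? c d x = (c ≤? x) ×-dec (x ≤? d)

  intervalCard : Fin n → Fin n → ℕ
  intervalCard c d = card (inInterval? c d)

  -- (x, y) ∈ P_{a,b}(L): x ∧ y ≤ z ≤ x ∨ y for all z ∈ {a, b}
  InP₂ : Fin n → Fin n → Fin n × Fin n → Set
  InP₂ a b (x , y) = ((x ∧ y) ≤ a × a ≤ (x ∨ y)) × ((x ∧ y) ≤ b × b ≤ (x ∨ y))

  inP₂? : (a b : Fin n) → Decidable (InP₂ a b)
  inP₂? a b (x , y) =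
    (((x ∧ y) ≤? a) ×-dec (a ≤? (x ∨ y))) ×-dec (((x ∧ y) ≤? b) ×-dec (b ≤? (x ∨ y)))

  PCard : Fin n → Fin n → ℕ
  PCard a b = card₂ (inP₂? a b)

  Compl : Fin n → Fin n → Fin n × Fin n → Set
  Compl a b (x , y) =
    ((a < x × x < b) × (a < y × y < b)) × ((x ∧ y) ≡ a × (x ∨ y) ≡ b)

  compl? : (a b : Fin n) → Decidable (Compl a b)
  compl? a b (x , y) =
    (((a <? x) ×-dec (x <? b)) ×-dec ((a <? y) ×-dec (y <? b)))
      ×-dec (((x ∧ y) ≟ a) ×-dec ((x ∨ y) ≟ b))

  ComplCard : Fin n → Fin n → ℕ
  ComplCard a b = card₂ (compl? a b)

-- Since a ≤ b, a pair (x , y) lies in P_{a,b} exactly when x ∧ y ≤ a and b ≤ x ∨ y. Every element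
-- lies in [0,a], in [b,1] or strictly between a and b. If one coordinate is ≤ a, the other must be ≥ b
-- (and dually), giving the products [0,a] × [b,1] and [b,1] × [0,a]; otherwise both coordinates lie
-- strictly between a and b, and x ∧ y ≤ a, b ≤ x ∨ y force x ∧ y = a, x ∨ y = b. The three classes
-- are disjoint, so the count splits into 2 |[0,a]| |[b,1]| plus the number of complementary pairs.
module Submission where

open import Defs
open import Algebra.Lattice.Bundles using (Lattice)
open import Algebra.Lattice.Structures using (IsLattice)
import Algebra.Lattice.Properties.Lattice as LatticeProperties
import Relation.Binary.Lattice as OrderTheoretic
open import Data.Empty using (⊥-elim)
open import Level using (0ℓ)
open import Data.Fin using (Fin)
open import Data.List using (List; []; _∷_; length; filter; map; allFin; cartesianProduct)
open import Data.List.Properties using (length-++; filter-++; filter-≐)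
open import Data.Nat using (ℕ; suc; _+_; _*_)
open import Data.Nat.Properties using (+-suc)
open import Data.Nat.Solver using (module +-*-Solver)
open import Data.Product using (_×_; _,_; proj₁; proj₂)
open import Data.Sum using (_⊎_; inj₁; inj₂)
open import Relation.Binary.PropositionalEquality
  using (_≡_; refl; sym; trans; cong; cong₂; subst; module ≡-Reasoning)
open import Relation.Nullary using (¬_; yes; no)
open import Relation.Unary using (Pred; Decidable; _⊆_; _∪_; _⟨×⟩_; _⊥_)
open import Relation.Unary.Properties using (_∪?_; _×?_)

length-filter-cartesianProduct-∷ : ∀ {A B : Set} {R : Pred (A × B) 0ℓ} (R? : Decidable R) x xs ys →
  length (filter R? (cartesianProduct (x ∷ xs) ys))
    ≡ length (filter R? (map (x ,_) ys)) + length (filter R? (cartesianProduct xs ys))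
length-filter-cartesianProduct-∷ R? x xs ys =
  trans (cong length (filter-++ R? (map (x ,_) ys) (cartesianProduct xs ys)))
        (length-++ (filter R? (map (x ,_) ys)))

module _ {A B : Set} {P : Pred A 0ℓ} {Q : Pred B 0ℓ} (P? : Decidable P) (Q? : Decidable Q) where

  length-filter-map-accept : ∀ {x} → P x → ∀ ys →
    length (filter (P? ×? Q?) (map (x ,_) ys)) ≡ length (filter Q? ys)
  length-filter-map-accept px [] = refl
  length-filter-map-accept {x} px (y ∷ ys) with P? x | Q? y
  ... | no ¬px | _     = ⊥-elim (¬px px)
  ... | yes _  | yes _ = cong suc (length-filter-map-accept px ys)
  ... | yes _  | no _  = length-filter-map-accept px ys

  length-filter-map-reject : ∀ {x} → ¬ P x → ∀ ys →
    length (filter (P? ×? Q?) (map (x ,_) ys)) ≡ 0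
  length-filter-map-reject ¬px [] = refl
  length-filter-map-reject {x} ¬px (y ∷ ys) with P? x
  ... | yes px = ⊥-elim (¬px px)
  ... | no _   = length-filter-map-reject ¬px ys

  length-filter-⟨×⟩ : ∀ xs ys →
    length (filter (P? ×? Q?) (cartesianProduct xs ys)) ≡ length (filter P? xs) * length (filter Q? ys)
  length-filter-⟨×⟩ []       ys = refl
  length-filter-⟨×⟩ (x ∷ xs) ys with P? x
  ... | yes px = trans (length-filter-cartesianProduct-∷ (P? ×? Q?) x xs ys)
                       (cong₂ _+_ (length-filter-map-accept px ys) (length-filter-⟨×⟩ xs ys))
  ... | no ¬px = trans (length-filter-cartesianProduct-∷ (P? ×? Q?) x xs ys)
                       (cong₂ _+_ (length-filter-map-reject ¬px ys) (length-filter-⟨×⟩ xs ys))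

module _ {A : Set} {P Q : Pred A 0ℓ} (P? : Decidable P) (Q? : Decidable Q) where

  length-filter-∪ : P ⊥ Q → ∀ xs →
    length (filter (P? ∪? Q?) xs) ≡ length (filter P? xs) + length (filter Q? xs)
  length-filter-∪ P⊥Q []       = refl
  length-filter-∪ P⊥Q (x ∷ xs) with P? x | Q? x
  ... | yes px | yes qx = ⊥-elim (P⊥Q (px , qx))
  ... | yes _  | no _   = cong suc (length-filter-∪ P⊥Q xs)
  ... | no _   | yes _  = trans (cong suc (length-filter-∪ P⊥Q xs)) (sym (+-suc _ _))
  ... | no _   | no _   = length-filter-∪ P⊥Q xs

module LatticeOrder {n : ℕ} {_∨_ _∧_ : Fin n → Fin n → Fin n} (isLattice : IsLattice _≡_ _∨_ _∧_) where
  open LatticeNotions _∨_ _∧_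

  private
    lattice : Lattice 0ℓ 0ℓ
    lattice = record { isLattice = isLattice }
    module O = OrderTheoretic.Lattice (LatticeProperties.∨-∧-orderTheoreticLattice lattice)

  -- The library orients the defining equation of the natural order as x ≡ x ∧ y.

  ≤-reflexive : ∀ {x y} → x ≡ y → x ≤ y
  ≤-reflexive refl = sym O.refl

  ≤-trans : ∀ {x y z} → x ≤ y → y ≤ z → x ≤ z
  ≤-trans x≤y y≤z = sym (O.trans (sym x≤y) (sym y≤z))

  ≤-antisym : ∀ {x y} → x ≤ y → y ≤ x → x ≡ y
  ≤-antisym x≤y y≤x = O.antisym (sym x≤y) (sym y≤x)

  x∧y≤x : ∀ x y → (x ∧ y) ≤ x
  x∧y≤x x y = sym (O.x∧y≤x x y)

  x∧y≤y : ∀ x y → (x ∧ y) ≤ y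
  x∧y≤y x y = sym (O.x∧y≤y x y)

  ∧-greatest : ∀ {x y z} → z ≤ x → z ≤ y → z ≤ (x ∧ y)
  ∧-greatest z≤x z≤y = sym (O.∧-greatest (sym z≤x) (sym z≤y))

  x≤x∨y : ∀ x y → x ≤ (x ∨ y)
  x≤x∨y x y = sym (O.x≤x∨y x y)

  y≤x∨y : ∀ x y → y ≤ (x ∨ y)
  y≤x∨y x y = sym (O.y≤x∨y x y)

  ∨-least : ∀ {x y z} → x ≤ z → y ≤ z → (x ∨ y) ≤ z
  ∨-least x≤z y≤z = sym (O.∨-least (sym x≤z) (sym y≤z))

module _ {n : ℕ} {_∨_ _∧_ : Fin n → Fin n → Fin n} where
  open LatticeNotions _∨_ _∧_

  module ThreeIntervals (isLattice : IsLattice _≡_ _∨_ _∧_)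
    {𝟎 𝟏 : Fin n} (𝟎≤ : ∀ x → 𝟎 ≤ x) (≤𝟏 : ∀ x → x ≤ 𝟏)
    {a b : Fin n} (a<b : a < b)
    (cover : ∀ x → InInterval 𝟎 a x ⊎ InInterval a b x ⊎ InInterval b 𝟏 x) where
    open LatticeOrder isLattice
    open IsLattice isLattice using (∨-comm; ∧-comm)

    Lower Upper : Pred (Fin n) 0ℓ
    Lower = InInterval 𝟎 a
    Upper = InInterval b 𝟏

    lower : ∀ {x} → x ≤ a → Lower x
    lower x≤a = 𝟎≤ _ , x≤a

    upper : ∀ {x} → b ≤ x → Upper x
    upper b≤x = b≤x , ≤𝟏 _

    a≤b : a ≤ b
    a≤b = proj₁ a<b

    b≰a : ¬ b ≤ a
    b≰a b≤a = proj₂ a<b (≤-antisym a≤b b≤a)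

    x≰a⇒b≰x⇒a<x<b : ∀ {x} → ¬ x ≤ a → ¬ b ≤ x → a < x × x < b
    x≰a⇒b≰x⇒a<x<b {x} x≰a b≰x with cover x
    ... | inj₁ (_ , x≤a)          = ⊥-elim (x≰a x≤a)
    ... | inj₂ (inj₂ (b≤x , _))   = ⊥-elim (b≰x b≤x)
    ... | inj₂ (inj₁ (a≤x , x≤b)) =
      (a≤x , λ a≡x → x≰a (≤-reflexive (sym a≡x))) , (x≤b , λ x≡b → b≰x (≤-reflexive (sym x≡b)))

    x≤a⇒b≤x∨y⇒b≤y : ∀ {x y} → x ≤ a → b ≤ (x ∨ y) → b ≤ y
    x≤a⇒b≤x∨y⇒b≤y {x} {y} x≤a b≤x∨y with cover y
    ... | inj₁ (_ , y≤a)        = ⊥-elim (b≰a (≤-trans b≤x∨y (∨-least x≤a y≤a)))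
    ... | inj₂ (inj₁ (a≤y , _)) = ≤-trans b≤x∨y (∨-least (≤-trans x≤a a≤y) (≤-reflexive refl))
    ... | inj₂ (inj₂ (b≤y , _)) = b≤y

    b≤x⇒x∧y≤a⇒y≤a : ∀ {x y} → b ≤ x → (x ∧ y) ≤ a → y ≤ a
    b≤x⇒x∧y≤a⇒y≤a {x} {y} b≤x x∧y≤a with cover y
    ... | inj₁ (_ , y≤a)        = y≤a
    ... | inj₂ (inj₁ (_ , y≤b)) = ≤-trans (∧-greatest (≤-trans y≤b b≤x) (≤-reflexive refl)) x∧y≤a
    ... | inj₂ (inj₂ (b≤y , _)) = ⊥-elim (b≰a (≤-trans (∧-greatest b≤x b≤y) x∧y≤a))

    Decomposition : Pred (Fin n × Fin n) 0ℓ
    Decomposition = (Lower ⟨×⟩ Upper) ∪ (Upper ⟨×⟩ Lower) ∪ Compl a b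

    inP₂ : ∀ {x y} → (x ∧ y) ≤ a → b ≤ (x ∨ y) → InP₂ a b (x , y)
    inP₂ x∧y≤a b≤x∨y = (x∧y≤a , ≤-trans a≤b b≤x∨y) , (≤-trans x∧y≤a a≤b , b≤x∨y)

    compl : ∀ {x y} → a < x × x < b → a < y × y < b → (x ∧ y) ≤ a → b ≤ (x ∨ y) → Compl a b (x , y)
    compl x∈ab@((a≤x , _) , (x≤b , _)) y∈ab@((a≤y , _) , (y≤b , _)) x∧y≤a b≤x∨y =
      (x∈ab , y∈ab) , (≤-antisym x∧y≤a (∧-greatest a≤x a≤y) , ≤-antisym (∨-least x≤b y≤b) b≤x∨y)

    InP₂⊆Decomposition : InP₂ a b ⊆ Decomposition
    InP₂⊆Decomposition {x , y} ((x∧y≤a , _) , (_ , b≤x∨y)) with x ≤? a | b ≤? x | y ≤? a | b ≤? y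
    ... | yes x≤a | _       | _       | _       = inj₁ (lower x≤a , upper (x≤a⇒b≤x∨y⇒b≤y x≤a b≤x∨y))
    ... | no _    | yes b≤x | _       | _       = inj₂ (inj₁ (upper b≤x , lower (b≤x⇒x∧y≤a⇒y≤a b≤x x∧y≤a)))
    ... | no _    | no _    | yes y≤a | _       = inj₂ (inj₁ (upper (x≤a⇒b≤x∨y⇒b≤y y≤a b≤y∨x) , lower y≤a))
      where
      b≤y∨x : b ≤ (y ∨ x)
      b≤y∨x = subst (b ≤_) (∨-comm x y) b≤x∨y
    ... | no _    | no _    | no _    | yes b≤y = inj₁ (lower (b≤x⇒x∧y≤a⇒y≤a b≤y y∧x≤a) , upper b≤y)
      where
      y∧x≤a : (y ∧ x) ≤ a
      y∧x≤a = subst (_≤ a) (∧-comm x y) x∧y≤a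
    ... | no x≰a  | no b≰x  | no y≰a  | no b≰y  =
      inj₂ (inj₂ (compl (x≰a⇒b≰x⇒a<x<b x≰a b≰x) (x≰a⇒b≰x⇒a<x<b y≰a b≰y) x∧y≤a b≤x∨y))

    Decomposition⊆InP₂ : Decomposition ⊆ InP₂ a b
    Decomposition⊆InP₂ {x , y} (inj₁ ((_ , x≤a) , (b≤y , _))) =
      inP₂ (≤-trans (x∧y≤x x y) x≤a) (≤-trans b≤y (y≤x∨y x y))
    Decomposition⊆InP₂ {x , y} (inj₂ (inj₁ ((b≤x , _) , (_ , y≤a)))) =
      inP₂ (≤-trans (x∧y≤y x y) y≤a) (≤-trans b≤x (x≤x∨y x y))
    Decomposition⊆InP₂ (inj₂ (inj₂ (_ , (x∧y≡a , x∨y≡b)))) =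
      inP₂ (≤-reflexive x∧y≡a) (≤-reflexive (sym x∨y≡b))

    Lower×Upper⊥rest : (Lower ⟨×⟩ Upper) ⊥ ((Upper ⟨×⟩ Lower) ∪ Compl a b)
    Lower×Upper⊥rest (((_ , x≤a) , _) , inj₁ ((b≤x , _) , _))          = b≰a (≤-trans b≤x x≤a)
    Lower×Upper⊥rest (((_ , x≤a) , _) , inj₂ ((((a≤x , a≢x) , _) , _) , _)) = a≢x (≤-antisym a≤x x≤a)

    Upper×Lower⊥Compl : (Upper ⟨×⟩ Lower) ⊥ Compl a b
    Upper×Lower⊥Compl (((b≤x , _) , _) , (((_ , (x≤b , x≢b)) , _) , _)) = x≢b (≤-antisym x≤b b≤x)

    PCard-decomposition : PCard a b ≡ intervalCard 𝟎 a * intervalCard b 𝟏 + (intervalCard b 𝟏 * intervalCard 𝟎 a + ComplCard a b)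
    PCard-decomposition = begin
      PCard a b
        ≡⟨ cong length (filter-≐ (inP₂? a b) decomposition? (InP₂⊆Decomposition , Decomposition⊆InP₂) pairs) ⟩
      length (filter decomposition? pairs)
        ≡⟨ length-filter-∪ lower×upper? (upper×lower? ∪? compl? a b) Lower×Upper⊥rest pairs ⟩
      length (filter lower×upper? pairs) + length (filter (upper×lower? ∪? compl? a b) pairs)
        ≡⟨ cong₂ _+_ (length-filter-⟨×⟩ lower? upper? (allFin n) (allFin n))
                     (length-filter-∪ upper×lower? (compl? a b) Upper×Lower⊥Compl pairs) ⟩
      intervalCard 𝟎 a * intervalCard b 𝟏 + (length (filter upper×lower? pairs) + ComplCard a b)
        ≡⟨ cong (λ k → intervalCard 𝟎 a * intervalCard b 𝟏 + (k + ComplCard a b))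
                (length-filter-⟨×⟩ upper? lower? (allFin n) (allFin n)) ⟩
      intervalCard 𝟎 a * intervalCard b 𝟏 + (intervalCard b 𝟏 * intervalCard 𝟎 a + ComplCard a b) ∎
      where
      open ≡-Reasoning
      pairs : List (Fin n × Fin n)
      pairs = cartesianProduct (allFin n) (allFin n)
      lower? : Decidable Lower
      lower? = inInterval? 𝟎 a
      upper? : Decidable Upper
      upper? = inInterval? b 𝟏
      lower×upper? : Decidable (Lower ⟨×⟩ Upper)
      lower×upper? = lower? ×? upper?
      upper×lower? : Decidable (Upper ⟨×⟩ Lower)
      upper×lower? = upper? ×? lower?
      decomposition? : Decidable Decomposition
      decomposition? = lower×upper? ∪? (upper×lower? ∪? compl? a b)

lemma16 : (n : ℕ) (_∨_ _∧_ : Fin n → Fin n → Fin n) →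
          IsLattice _≡_ _∨_ _∧_ →
          let open LatticeNotions _∨_ _∧_ in
          (𝟎 𝟏 : Fin n) → (∀ x → 𝟎 ≤ x) → (∀ x → x ≤ 𝟏) →
          (a b : Fin n) → a < b →
          (∀ x → InInterval 𝟎 a x ⊎ InInterval a b x ⊎ InInterval b 𝟏 x) →
          PCard a b ≡ 2 * intervalCard 𝟎 a * intervalCard b 𝟏 + ComplCard a b
lemma16 n _∨_ _∧_ isLattice 𝟎 𝟏 𝟎≤ ≤𝟏 a b a<b cover =
  trans (ThreeIntervals.PCard-decomposition isLattice 𝟎≤ ≤𝟏 a<b cover)
        (p*q+[q*p+c]≡2*p*q+c (intervalCard 𝟎 a) (intervalCard b 𝟏) (ComplCard a b))
  where
  open LatticeNotions _∨_ _∧_ using (intervalCard; ComplCard)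
  open +-*-Solver using (solve; _:*_; _:+_; _:=_; con)
  p*q+[q*p+c]≡2*p*q+c : ∀ p q c → p * q + (q * p + c) ≡ 2 * p * q + c
  p*q+[q*p+c]≡2*p*q+c = solve 3 (λ p q c → p :* q :+ (q :* p :+ c) := con 2 :* p :* q :+ c) refl
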